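{- Let $G$ be a snake graph coloured so that all turns are black, equipped with a Kasteleyn weighting, with weighted bipartite adjacency matrix $B$. If $i$ is a black vertex on the upper boundary and $j$ is a black vertex on the lower boundary of $G$, then $(BB^T)_{ij}=0$.
   Context: A snake graph is a plane graph formed by a finite sequence of unit square tiles $T_1,\dots,T_N$, each $T_{i+1}$ placed immediately to the right of or on top of $T_i$, consecutive tiles sharing exactly one edge; vertices are coloured black and white with adjacent vertices of different colours. A vertex is a turn if it has exactly $2$ or exactly $4$ neighbours and is neither the lower-right, lower-left nor upper-left vertex of $T_1$, nor the upper-left, upper-right or lower-right vertex of $T_N$. For $N\geq2$, the start edge is the edge of $T_1$ joining the two vertices of $T_1$ not in $T_2$ and the end edge is defined analogously for $T_N$; removing these from the cycle of edges bounding the unbounded face leaves two disjoint paths, the upper and lower boundary (the one containing the lower-left vertex of $T_1$ is the upper boundary if $T_2$ is above $T_1$, otherwise the lower boundary); for $N=1$ they are the top and bottom edges. A weighting $w:E\to\{\pm1\}$ is Kasteleyn if every face (including the unbounded one) bounded by a $k$-cycle has an odd number of edges of weight $-1$ when $k\equiv0\bmod4$ and an even number when $k\equiv2\bmod4$. $B$ has rows indexed by black vertices and columns by white vertices, entry $w(e)$ if joined by edge $e$, else $0$. -}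

module Defs where

open import Data.Nat using (ℕ; zero; suc; _%_)
open import Data.Nat.Properties using () renaming (_≟_ to _≟ℕ_)
open import Data.Integer using (ℤ; 0ℤ; _+_; _*_; _◃_)
open import Data.Sign using (Sign) renaming (+ to plus; - to minus)
import Data.Sign.Properties as SignP
open import Data.Bool using (Bool; true; false; if_then_else_)
open import Data.List using (List; []; _∷_; map; concatMap; filter; filterᵇ; length; foldr; upTo; cartesianProduct)
open import Data.List.Membership.Propositional using (_∈_)
import Data.List.Membership.DecPropositional as DecMem
open import Data.List.Relation.Unary.All using (All)
open import Data.Maybe using (Maybe; just; nothing; maybe)
open import Data.Product using (_×_; _,_; ∃)
open import Data.Product.Properties using (≡-dec)
open import Data.Sum using (_⊎_)
open import Relation.Binary.PropositionalEquality using (_≡_; refl; cong₂)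
open import Relation.Binary.Definitions using (DecidableEquality)
open import Relation.Nullary using (¬_; Dec; yes; no; does)

-- A snake graph with N = 1 + length ds tiles is encoded by the list ds of
-- directions: T₁ is the unit square with lower-left corner (0,0), and
-- T_{i+1} is placed to the right (R) or on top (U) of T_i.
-- Vertices are lattice points, tiles are named by their lower-left corner.

data Dir : Set where
  R U : Dir

Point : Set
Point = ℕ × ℕ

_≟P_ : DecidableEquality Point
_≟P_ = ≡-dec _≟ℕ_ _≟ℕ_

step : Point → Dir → Point
step (x , y) R = (suc x , y)
step (x , y) U = (x , suc y)

tilesFrom : Point → List Dir → List Point
tilesFrom p []       = p ∷ []
tilesFrom p (d ∷ ds) = p ∷ tilesFrom (step p d) ds

tiles : List Dir → List Point
tiles = tilesFrom (0 , 0)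

numTiles : List Dir → ℕ
numTiles ds = suc (length ds)

lastTileFrom : Point → List Dir → Point
lastTileFrom p []       = p
lastTileFrom p (d ∷ ds) = lastTileFrom (step p d) ds

lastTile : List Dir → Point
lastTile = lastTileFrom (0 , 0)

-- lower-left corner of T_{N-1} (only meaningful for N ≥ 2)
penultTileFrom : Point → List Dir → Point
penultTileFrom p []            = p
penultTileFrom p (d ∷ [])      = p
penultTileFrom p (d ∷ e ∷ ds)  = penultTileFrom (step p d) (e ∷ ds)

penultTile : List Dir → Point
penultTile = penultTileFrom (0 , 0)

lowerLeft lowerRight upperLeft upperRight : Point → Point
lowerLeft  (x , y) = (x , y)
lowerRight (x , y) = (suc x , y)
upperLeft  (x , y) = (x , suc y)
upperRight (x , y) = (suc x , suc y)

corners : Point → List Point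
corners p = lowerLeft p ∷ lowerRight p ∷ upperLeft p ∷ upperRight p ∷ []

data Edge : Set where
  hor ver : ℕ → ℕ → Edge

_≟E_ : DecidableEquality Edge
hor a b ≟E hor c d with a ≟ℕ c | b ≟ℕ d
... | yes refl | yes refl = yes refl
... | no ne    | _        = no λ { refl → ne refl }
... | yes _    | no ne    = no λ { refl → ne refl }
ver a b ≟E ver c d with a ≟ℕ c | b ≟ℕ d
... | yes refl | yes refl = yes refl
... | no ne    | _        = no λ { refl → ne refl }
... | yes _    | no ne    = no λ { refl → ne refl }
hor _ _ ≟E ver _ _ = no λ ()
ver _ _ ≟E hor _ _ = no λ ()

ends : Edge → Point × Point
ends (hor x y) = ((x , y) , (suc x , y))
ends (ver x y) = ((x , y) , (x , suc y))

Joins : Edge → Point → Point → Set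
Joins e p q = ends e ≡ (p , q) ⊎ ends e ≡ (q , p)

sides : Point → List Edge
sides (x , y) = hor x y ∷ hor x (suc y) ∷ ver x y ∷ ver (suc x) y ∷ []

-- vertices (with repetitions) and edges (with repetitions) of the snake graph
vertexList : List Dir → List Point
vertexList ds = concatMap corners (tiles ds)

edgeList : List Dir → List Edge
edgeList ds = concatMap sides (tiles ds)

IsVertex : List Dir → Point → Set
IsVertex ds p = p ∈ vertexList ds

IsEdge : List Dir → Edge → Set
IsEdge ds e = e ∈ edgeList ds

module MP = DecMem _≟P_
module ME = DecMem _≟E_

isEdgeᵇ : List Dir → Edge → Bool
isEdgeᵇ ds e = does (e ME.∈? edgeList ds)

edgeBetween : Point → Point → Maybe Edge
edgeBetween (x , y) (x' , y') with x' ≟ℕ suc x | x ≟ℕ suc x' | x ≟ℕ x' | y' ≟ℕ suc y | y ≟ℕ suc y' | y ≟ℕ y'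
... | yes _ | _     | _     | _     | _     | yes _ = just (hor x y)
... | _     | yes _ | _     | _     | _     | yes _ = just (hor x' y)
... | _     | _     | yes _ | yes _ | _     | _     = just (ver x y)
... | _     | _     | yes _ | _     | yes _ | _     = just (ver x y')
... | _     | _     | _     | _     | _     | _     = nothing

adjᵇ : List Dir → Point → Point → Bool
adjᵇ ds p q = maybe (isEdgeᵇ ds) false (edgeBetween p q)

latticeNbrs : Point → List Point
latticeNbrs (x , y) = (suc x , y) ∷ (x , suc y) ∷ (left x ++' (down y))
  where
  left : ℕ → List Point
  left zero    = []
  left (suc a) = (a , y) ∷ []
  down : ℕ → List Point
  down zero    = []
  down (suc b) = (x , b) ∷ []
  _++'_ : List Point → List Point → List Point
  []       ++' ys = ys
  (z ∷ zs) ++' ys = z ∷ (zs ++' ys)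

degree : List Dir → Point → ℕ
degree ds p = length (filterᵇ (adjᵇ ds p) (latticeNbrs p))

data Colour : Set where
  black white : Colour

_≟C_ : DecidableEquality Colour
black ≟C black = yes refl
white ≟C white = yes refl
black ≟C white = no λ ()
white ≟C black = no λ ()

ProperColouring : List Dir → (Point → Colour) → Set
ProperColouring ds col =
  ∀ e → IsEdge ds e → ¬ (col (Data.Product.proj₁ (ends e)) ≡ col (Data.Product.proj₂ (ends e)))

Excluded : List Dir → Point → Set
Excluded ds p =
  p ≡ lowerRight (0 , 0) ⊎ p ≡ lowerLeft (0 , 0) ⊎ p ≡ upperLeft (0 , 0) ⊎
  p ≡ upperLeft (lastTile ds) ⊎ p ≡ upperRight (lastTile ds) ⊎ p ≡ lowerRight (lastTile ds)

IsTurn : List Dir → Point → Set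
IsTurn ds p = IsVertex ds p × (degree ds p ≡ 2 ⊎ degree ds p ≡ 4) × ¬ Excluded ds p

tileCount : List Dir → Edge → ℕ
tileCount ds e = length (filter (λ t → e ME.∈? sides t) (tiles ds))

-- the edges of the cycle bounding the unbounded face: the edges lying on
-- exactly one tile (each listed once)
outerFace : List Dir → List Edge
outerFace ds = filter (λ e → tileCount ds e ≟ℕ 1) (edgeList ds)

OnOuterFace : List Dir → Edge → Set
OnOuterFace ds e = e ∈ outerFace ds

faces : List Dir → List (List Edge)
faces ds = outerFace ds ∷ map sides (tiles ds)

isMinus : Sign → Bool
isMinus minus = true
isMinus plus  = false

KasteleynFace : (Edge → Sign) → List Edge → Set
KasteleynFace w es =
  (length es % 4 ≡ 0 → length (filterᵇ (λ e → isMinus (w e)) es) % 2 ≡ 1) ×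
  (length es % 4 ≡ 2 → length (filterᵇ (λ e → isMinus (w e)) es) % 2 ≡ 0)

Kasteleyn : List Dir → (Edge → Sign) → Set
Kasteleyn ds w = All (KasteleynFace w) (faces ds)

IsStartEdge : List Dir → Edge → Set
IsStartEdge []       e = Data.Empty.⊥
  where import Data.Empty
IsStartEdge (d ∷ ds) e =
  e ∈ sides (0 , 0) ×
  ¬ (Data.Product.proj₁ (ends e) ∈ corners (step (0 , 0) d)) ×
  ¬ (Data.Product.proj₂ (ends e) ∈ corners (step (0 , 0) d))

IsEndEdge : List Dir → Edge → Set
IsEndEdge ds e =
  e ∈ sides (lastTile ds) ×
  ¬ (Data.Product.proj₁ (ends e) ∈ corners (penultTile ds)) ×
  ¬ (Data.Product.proj₂ (ends e) ∈ corners (penultTile ds))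

-- edges of the two boundary paths: outer cycle minus start and end edge
IsPathEdge : List Dir → Edge → Set
IsPathEdge ds e = OnOuterFace ds e × ¬ IsStartEdge ds e × ¬ IsEndEdge ds e

OnPaths : List Dir → Point → Set
OnPaths ds p = ∃ λ e → IsPathEdge ds e × (p ≡ Data.Product.proj₁ (ends e) ⊎ p ≡ Data.Product.proj₂ (ends e))

data PathReach (ds : List Dir) (a : Point) : Point → Set where
  here : PathReach ds a a
  next : ∀ {b c} e → PathReach ds a b → IsPathEdge ds e → Joins e b c → PathReach ds a c

OnPathOfOrigin : List Dir → Point → Set
OnPathOfOrigin ds p = PathReach ds (0 , 0) p

OnOtherPath : List Dir → Point → Set
OnOtherPath ds p = OnPaths ds p × ¬ PathReach ds (0 , 0) p

OnUpperBoundary : List Dir → Point → Set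
OnUpperBoundary []      p = p ≡ upperLeft (0 , 0) ⊎ p ≡ upperRight (0 , 0)
OnUpperBoundary (U ∷ ds) p = OnPathOfOrigin (U ∷ ds) p
OnUpperBoundary (R ∷ ds) p = OnOtherPath (R ∷ ds) p

OnLowerBoundary : List Dir → Point → Set
OnLowerBoundary []      p = p ≡ lowerLeft (0 , 0) ⊎ p ≡ lowerRight (0 , 0)
OnLowerBoundary (U ∷ ds) p = OnOtherPath (U ∷ ds) p
OnLowerBoundary (R ∷ ds) p = OnPathOfOrigin (R ∷ ds) p

signℤ : Sign → ℤ
signℤ s = s ◃ 1

B : List Dir → (Edge → Sign) → Point → Point → ℤ
B ds w b v with edgeBetween b v
... | nothing = 0ℤ
... | just e  = if isEdgeᵇ ds e then signℤ (w e) else 0ℤ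

-- all lattice points of the bounding box [0,N]², each once
box : List Dir → List Point
box ds = cartesianProduct (upTo (suc (numTiles ds))) (upTo (suc (numTiles ds)))

whiteVertices : List Dir → (Point → Colour) → List Point
whiteVertices ds col =
  filter (λ p → col p ≟C white) (filter (λ p → p MP.∈? vertexList ds) (box ds))

sumℤ : List ℤ → ℤ
sumℤ = foldr _+_ 0ℤ

BBᵀ : List Dir → (Point → Colour) → (Edge → Sign) → Point → Point → ℤ
BBᵀ ds col w i j = sumℤ (map (λ k → B ds w i k * B ds w j k) (whiteVertices ds col))

-- Only common white neighbours k of i and j contribute to (BBᵀ)ᵢⱼ, and such a k is not a turn.
-- The tiles of a snake lie on pairwise distinct anti-diagonals x + y = 0, …, N - 1. If i, k, j
-- are collinear, then either a tile sits diagonally next to k, making k a turn, or both edges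
-- through k lie on the outer face and are neither the start nor the end edge; then i and j lie on
-- the same boundary path, which is impossible for an upper and a lower vertex. If i, k, j form a
-- right angle, the unit square they span is a tile T (otherwise k would be a turn or two tiles
-- would share an anti-diagonal), so i and j are opposite corners of T. Their only common
-- neighbours are then the two other corners of T, and since the 4-cycle bounding T carries an odd
-- number of weights -1, the two products w(ik)w(jk) cancel.

module Submission where

open import Defs
open import Data.Integer using (0ℤ)
open import Data.Sign using (Sign)
open import Data.List using (List)
open import Relation.Binary.PropositionalEquality using (_≡_)

open import Data.Bool using (Bool; true; false)
open import Data.Empty using (⊥; ⊥-elim)
import Data.Integer as ℤ
import Data.Integer.Properties as ℤₚ
open import Data.List using ([]; _∷_; length; filter; filterᵇ; map; upTo)
open import Data.List.Membership.Propositional using (_∈_; find; lose)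
import Data.List.Membership.Propositional.Properties as ∈ₚ
import Data.List.Properties as Listₚ
open import Data.List.Relation.Unary.All as All using (All)
open import Data.List.Relation.Unary.AllPairs using ([]; _∷_)
open import Data.List.Relation.Unary.Any using (here; there)
open import Data.List.Relation.Unary.Unique.Propositional using (Unique)
import Data.List.Relation.Unary.Unique.Propositional.Properties as Uniqueₚ
open import Data.Maybe using (just; nothing)
open import Data.Nat using (ℕ; zero; suc; _+_; _%_; _≤_; _<_; s≤s)
open import Data.Nat.Properties
open import Data.Product using (∃; _×_; _,_; proj₁; proj₂)
open import Data.Sign using () renaming (+ to plus; - to minus)
open import Data.Sum using (_⊎_; inj₁; inj₂; swap; [_,_]′)
open import Relation.Binary.PropositionalEquality
  using (_≢_; refl; sym; trans; cong; cong₂; subst; ≢-sym; module ≡-Reasoning)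
open import Relation.Nullary using (¬_; Dec; yes; no)
open import Relation.Nullary.Decidable using (dec-true)
open import Relation.Unary using (Decidable)
open import Function using (_∘_)

length-filter≡1 : ∀ {A : Set} {P : A → Set} (P? : Decidable P) {xs t} →
                  Unique xs → t ∈ xs → P t → (∀ {s} → s ∈ xs → P s → s ≡ t) →
                  length (filter P? xs) ≡ 1
length-filter≡1 P? {x ∷ xs} (x∉ ∷ _) _ _ only with P? x
... | yes px = cong (suc ∘ length) (Listₚ.filter-none P? (All.tabulate λ s∈ ps →
                 All.lookup x∉ s∈ (trans (only (here refl) px) (sym (only (there s∈) ps)))))
length-filter≡1 P? (_ ∷ _) (here refl) pt _ | no ¬px = ⊥-elim (¬px pt)
length-filter≡1 P? (_ ∷ u) (there t∈) pt only | no _ =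
  length-filter≡1 P? u t∈ pt (only ∘ there)

length-filterᵇ-∘ : ∀ {A B : Set} (p : B → Bool) (f : A → B) xs →
                   length (filterᵇ (p ∘ f) xs) ≡ length (filterᵇ p (map f xs))
length-filterᵇ-∘ p f []       = refl
length-filterᵇ-∘ p f (x ∷ xs) with p (f x)
... | true  = cong suc (length-filterᵇ-∘ p f xs)
... | false = length-filterᵇ-∘ p f xs

≢-head : ∀ {A : Set} {x k : A} {xs} → All (x ≢_) xs → k ∈ xs → k ≢ x
≢-head x∉ k∈ = ≢-sym (All.lookup x∉ k∈)

module _ {A : Set} (f : A → ℤ.ℤ) where

  sumℤ-zero : ∀ xs → (∀ {k} → k ∈ xs → f k ≡ 0ℤ) → sumℤ (map f xs) ≡ 0ℤ
  sumℤ-zero []       _    = refl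
  sumℤ-zero (x ∷ xs) vanish =
    cong₂ ℤ._+_ (vanish (here refl)) (sumℤ-zero xs (vanish ∘ there))

  sumℤ-zero-or : ∀ {P : Set} xs → (∀ {k} → k ∈ xs → f k ≡ 0ℤ ⊎ P) →
                 sumℤ (map f xs) ≡ 0ℤ ⊎ P
  sumℤ-zero-or []       _ = inj₁ refl
  sumℤ-zero-or (x ∷ xs) h with h (here refl) | sumℤ-zero-or xs (h ∘ there)
  ... | inj₂ p   | _        = inj₂ p
  ... | inj₁ _   | inj₂ p   = inj₂ p
  ... | inj₁ f≡0 | inj₁ Σ≡0 = inj₁ (cong₂ ℤ._+_ f≡0 Σ≡0)

  sumℤ-single : ∀ xs {k₁} → Unique xs → k₁ ∈ xs →
                (∀ {k} → k ∈ xs → k ≢ k₁ → f k ≡ 0ℤ) → sumℤ (map f xs) ≡ f k₁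
  sumℤ-single (x ∷ xs) (x∉ ∷ _) (here refl) vanish =
    trans (cong (λ s → f x ℤ.+ s) (sumℤ-zero xs (λ k∈ → vanish (there k∈) (≢-head x∉ k∈))))
          (ℤₚ.+-identityʳ (f x))
  sumℤ-single (x ∷ xs) (x∉ ∷ u) (there k₁∈) vanish =
    trans (cong₂ ℤ._+_ (vanish (here refl) (All.lookup x∉ k₁∈))
                       (sumℤ-single xs u k₁∈ (vanish ∘ there)))
          (ℤₚ.+-identityˡ _)

  sumℤ-pair : ∀ xs {k₁ k₂} → Unique xs → k₁ ∈ xs → k₂ ∈ xs → k₁ ≢ k₂ →
              (∀ {k} → k ∈ xs → k ≢ k₁ → k ≢ k₂ → f k ≡ 0ℤ) →
              sumℤ (map f xs) ≡ f k₁ ℤ.+ f k₂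
  sumℤ-pair (x ∷ xs) _ (here refl) (here refl) k₁≢k₂ _ = ⊥-elim (k₁≢k₂ refl)
  sumℤ-pair (x ∷ xs) (x∉ ∷ u) (here refl) (there k₂∈) _ vanish =
    cong (λ s → f x ℤ.+ s) (sumℤ-single xs u k₂∈ (λ k∈ → vanish (there k∈) (≢-head x∉ k∈)))
  sumℤ-pair (x ∷ xs) (x∉ ∷ u) (there k₁∈) (here refl) _ vanish =
    trans (cong (λ s → f x ℤ.+ s)
                (sumℤ-single xs u k₁∈ (λ k∈ k≢k₁ → vanish (there k∈) k≢k₁ (≢-head x∉ k∈))))
          (ℤₚ.+-comm (f x) _)
  sumℤ-pair (x ∷ xs) (x∉ ∷ u) (there k₁∈) (there k₂∈) k₁≢k₂ vanish =
    trans (cong₂ ℤ._+_ (vanish (here refl) (All.lookup x∉ k₁∈) (All.lookup x∉ k₂∈))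
                       (sumℤ-pair xs u k₁∈ k₂∈ k₁≢k₂ (vanish ∘ there)))
          (ℤₚ.+-identityˡ _)

-- Tiles and their ranks

rank : Point → ℕ
rank (x , y) = x + y

rank-step : ∀ p d → rank (step p d) ≡ suc (rank p)
rank-step (x , y) R = refl
rank-step (x , y) U = +-suc x y

rank-step-+ : ∀ p d n → rank (step p d) + n ≡ rank p + suc n
rank-step-+ p d n = trans (cong (_+ n) (rank-step p d)) (sym (+-suc (rank p) n))

tilesFrom-head : ∀ p ds → p ∈ tilesFrom p ds
tilesFrom-head p []       = here refl
tilesFrom-head p (d ∷ ds) = here refl

rank-tilesFrom-≥ : ∀ p ds {t} → t ∈ tilesFrom p ds → rank p ≤ rank t
rank-tilesFrom-≥ p []       (here refl) = ≤-refl
rank-tilesFrom-≥ p (d ∷ ds) (here refl) = ≤-refl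
rank-tilesFrom-≥ p (d ∷ ds) {t} (there t∈) =
  ≤-trans (n≤1+n _) (subst (_≤ rank t) (rank-step p d) (rank-tilesFrom-≥ (step p d) ds t∈))

rank-tilesFrom-step-> : ∀ p d ds {t} → t ∈ tilesFrom (step p d) ds → rank p < rank t
rank-tilesFrom-step-> p d ds {t} t∈ =
  subst (_≤ rank t) (rank-step p d) (rank-tilesFrom-≥ (step p d) ds t∈)

rank-tilesFrom-≤ : ∀ p ds {t} → t ∈ tilesFrom p ds → rank t ≤ rank p + length ds
rank-tilesFrom-≤ p []       (here refl) = ≤-reflexive (sym (+-identityʳ _))
rank-tilesFrom-≤ p (d ∷ ds) (here refl) = m≤m+n _ _
rank-tilesFrom-≤ p (d ∷ ds) (there t∈) =
  ≤-trans (rank-tilesFrom-≤ (step p d) ds t∈) (≤-reflexive (rank-step-+ p d (length ds)))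

rank-tilesFrom-injective : ∀ p ds {t t'} → t ∈ tilesFrom p ds → t' ∈ tilesFrom p ds →
                           rank t ≡ rank t' → t ≡ t'
rank-tilesFrom-injective p []       (here refl) (here refl) _ = refl
rank-tilesFrom-injective p (d ∷ ds) (here refl) (here refl) _ = refl
rank-tilesFrom-injective p (d ∷ ds) (here refl) (there t'∈) eq =
  ⊥-elim (<-irrefl eq (rank-tilesFrom-step-> p d ds t'∈))
rank-tilesFrom-injective p (d ∷ ds) (there t∈) (here refl) eq =
  ⊥-elim (<-irrefl (sym eq) (rank-tilesFrom-step-> p d ds t∈))
rank-tilesFrom-injective p (d ∷ ds) (there t∈) (there t'∈) eq =
  rank-tilesFrom-injective (step p d) ds t∈ t'∈ eq

tilesFrom-unique : ∀ p ds → Unique (tilesFrom p ds)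
tilesFrom-unique p []       = All.[] ∷ []
tilesFrom-unique p (d ∷ ds) =
  All.tabulate (λ t∈ p≡t → <-irrefl (cong rank p≡t) (rank-tilesFrom-step-> p d ds t∈))
  ∷ tilesFrom-unique (step p d) ds

lastTileFrom-∈ : ∀ p ds → lastTileFrom p ds ∈ tilesFrom p ds
lastTileFrom-∈ p []       = here refl
lastTileFrom-∈ p (d ∷ ds) = there (lastTileFrom-∈ (step p d) ds)

rank-lastTileFrom : ∀ p ds → rank (lastTileFrom p ds) ≡ rank p + length ds
rank-lastTileFrom p []       = sym (+-identityʳ _)
rank-lastTileFrom p (d ∷ ds) = trans (rank-lastTileFrom (step p d) ds) (rank-step-+ p d (length ds))

penultTileFrom-∈ : ∀ p d ds → penultTileFrom p (d ∷ ds) ∈ tilesFrom p (d ∷ ds)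
penultTileFrom-∈ p d []       = here refl
penultTileFrom-∈ p d (e ∷ ds) = there (penultTileFrom-∈ (step p d) e ds)

lastTileFrom-step-penult : ∀ p d ds →
                           ∃ λ d' → lastTileFrom p (d ∷ ds) ≡ step (penultTileFrom p (d ∷ ds)) d'
lastTileFrom-step-penult p d []       = d , refl
lastTileFrom-step-penult p d (e ∷ ds) = lastTileFrom-step-penult (step p d) e ds

rank-upper-or-right-corner : ∀ t {p} →
  p ≡ upperLeft t ⊎ p ≡ upperRight t ⊎ p ≡ lowerRight t → rank t < rank p
rank-upper-or-right-corner (x , y) (inj₁ refl)        = ≤-reflexive (sym (+-suc x y))
rank-upper-or-right-corner (x , y) (inj₂ (inj₁ refl)) = s≤s (+-monoʳ-≤ x (n≤1+n y))
rank-upper-or-right-corner (x , y) (inj₂ (inj₂ refl)) = ≤-refl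

pattern bottom∈ = here refl
pattern top∈    = there (here refl)
pattern left∈   = there (there (here refl))
pattern right∈  = there (there (there (here refl)))

pattern lowerLeft∈  = here refl
pattern lowerRight∈ = there (here refl)
pattern upperLeft∈  = there (there (here refl))
pattern upperRight∈ = there (there (there (here refl)))

hor∈sides : ∀ {x y t} → hor x y ∈ sides t → t ≡ (x , y) ⊎ ∃ λ y' → y ≡ suc y' × t ≡ (x , y')
hor∈sides              bottom∈                 = inj₁ refl
hor∈sides {t = _ , ty} top∈                    = inj₂ (ty , refl , refl)
hor∈sides              (there (there (here ())))
hor∈sides              (there (there (there (here ()))))

ver∈sides : ∀ {x y t} → ver x y ∈ sides t → t ≡ (x , y) ⊎ ∃ λ x' → x ≡ suc x' × t ≡ (x' , y)
ver∈sides              (here ())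
ver∈sides              (there (here ()))
ver∈sides              left∈                   = inj₁ refl
ver∈sides {t = tx , _} right∈                  = inj₂ (tx , refl , refl)

-- Lattice steps

data Step : Point → Point → Edge → Set where
  east  : ∀ {x y} → Step (x , y) (suc x , y) (hor x y)
  west  : ∀ {x y} → Step (suc x , y) (x , y) (hor x y)
  north : ∀ {x y} → Step (x , y) (x , suc y) (ver x y)
  south : ∀ {x y} → Step (x , suc y) (x , y) (ver x y)

n≢2+n : ∀ n → n ≢ suc (suc n)
n≢2+n n = m≢1+n+m n {1}

edgeBetween⇒Step : ∀ p q {e} → edgeBetween p q ≡ just e → Step p q e
edgeBetween⇒Step (x , y) (x' , y') eq
  with x' ≟ suc x | x ≟ suc x' | x ≟ x' | y' ≟ suc y | y ≟ suc y' | y ≟ y'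
... | yes refl | _        | _        | _        | _        | yes refl with refl ← eq = east
... | yes refl | yes x≡   | _        | _        | _        | no _  = ⊥-elim (n≢2+n x x≡)
... | yes refl | no _     | yes x≡   | _        | _        | no _  = ⊥-elim (1+n≢n (sym x≡))
... | yes refl | no _     | no _     | _        | _        | no _  with () ← eq
... | no _     | yes refl | _        | _        | _        | yes refl with refl ← eq = west
... | no _     | yes refl | yes x≡   | _        | _        | no _  = ⊥-elim (1+n≢n x≡)
... | no _     | yes refl | no _     | _        | _        | no _  with () ← eq
... | no _     | no _     | yes refl | yes refl | _        | _ with refl ← eq = north
... | no _     | no _     | yes refl | no _     | yes refl | _ with refl ← eq = south
... | no _     | no _     | yes refl | no _     | no _     | _ with () ← eq
... | no _     | no _     | no _     | _        | _        | _ with () ← eq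

Step⇒edgeBetween : ∀ {p q e} → Step p q e → edgeBetween p q ≡ just e
Step⇒edgeBetween (east {x} {y})
  with suc x ≟ suc x | x ≟ suc (suc x) | x ≟ suc x | y ≟ suc y | y ≟ suc y | y ≟ y
... | yes _ | _ | _ | _ | _ | yes _ = refl
... | no ≢  | _ | _ | _ | _ | _     = ⊥-elim (≢ refl)
... | yes _ | _ | _ | _ | _ | no ≢  = ⊥-elim (≢ refl)
Step⇒edgeBetween (west {x} {y})
  with x ≟ suc (suc x) | suc x ≟ suc x | suc x ≟ x | y ≟ suc y | y ≟ suc y | y ≟ y
... | yes x≡ | _     | _ | _ | _ | _     = ⊥-elim (n≢2+n x x≡)
... | no _   | yes _ | _ | _ | _ | yes _ = refl
... | no _   | no ≢  | _ | _ | _ | _     = ⊥-elim (≢ refl)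
... | no _   | yes _ | _ | _ | _ | no ≢  = ⊥-elim (≢ refl)
Step⇒edgeBetween (north {x} {y})
  with x ≟ suc x | x ≟ suc x | x ≟ x | suc y ≟ suc y | y ≟ suc (suc y) | y ≟ suc y
... | yes x≡ | _      | _     | _     | _ | _ = ⊥-elim (1+n≢n (sym x≡))
... | no _   | yes x≡ | _     | _     | _ | _ = ⊥-elim (1+n≢n (sym x≡))
... | no _   | no _   | yes _ | yes _ | _ | _ = refl
... | no _   | no _   | no ≢  | _     | _ | _ = ⊥-elim (≢ refl)
... | no _   | no _   | yes _ | no ≢  | _ | _ = ⊥-elim (≢ refl)
Step⇒edgeBetween (south {x} {y})
  with x ≟ suc x | x ≟ suc x | x ≟ x | y ≟ suc (suc y) | suc y ≟ suc y | suc y ≟ y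
... | yes x≡ | _      | _     | _      | _     | _ = ⊥-elim (1+n≢n (sym x≡))
... | no _   | yes x≡ | _     | _      | _     | _ = ⊥-elim (1+n≢n (sym x≡))
... | no _   | no _   | yes _ | yes y≡ | _     | _ = ⊥-elim (n≢2+n y y≡)
... | no _   | no _   | yes _ | no _   | yes _ | _ = refl
... | no _   | no _   | no ≢  | _      | _     | _ = ⊥-elim (≢ refl)
... | no _   | no _   | yes _ | no _   | no ≢  | _ = ⊥-elim (≢ refl)

Step⇒Joins : ∀ {p q e} → Step p q e → Joins e p q
Step⇒Joins east  = inj₁ refl
Step⇒Joins west  = inj₂ refl
Step⇒Joins north = inj₁ refl
Step⇒Joins south = inj₂ refl

Joins-sym : ∀ {e p q} → Joins e p q → Joins e q p
Joins-sym = swap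

diagonal-common-neighbour : ∀ {x y k e₁ e₂} → Step (x , y) k e₁ → Step (suc x , suc y) k e₂ →
                            k ≡ (suc x , y) ⊎ k ≡ (x , suc y)
diagonal-common-neighbour east  south = inj₁ refl
diagonal-common-neighbour north west  = inj₂ refl

antidiagonal-common-neighbour : ∀ {x y k e₁ e₂} → Step (suc x , y) k e₁ → Step (x , suc y) k e₂ →
                                k ≡ (x , y) ⊎ k ≡ (suc x , suc y)
antidiagonal-common-neighbour west  south = inj₁ refl
antidiagonal-common-neighbour north east  = inj₂ refl

-- The geometry of one snake graph

module Snake (ds : List Dir) where

  Tile : Point → Set
  Tile t = t ∈ tiles ds

  tile? : ∀ t → Dec (Tile t)
  tile? t = t MP.∈? tiles ds

  tile-rank-≤ : ∀ {t} → Tile t → rank t ≤ length ds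
  tile-rank-≤ = rank-tilesFrom-≤ (0 , 0) ds

  tile-rank-injective : ∀ {t t'} → Tile t → Tile t' → rank t ≡ rank t' → t ≡ t'
  tile-rank-injective = rank-tilesFrom-injective (0 , 0) ds

  rank-lastTile : rank (lastTile ds) ≡ length ds
  rank-lastTile = rank-lastTileFrom (0 , 0) ds

  lastTile≡⇒tile : ∀ {t} → lastTile ds ≡ t → Tile t
  lastTile≡⇒tile eq = subst Tile eq (lastTileFrom-∈ (0 , 0) ds)

  lastTile-rank-maximal : ∀ {t t'} → Tile t' → rank t < rank t' → lastTile ds ≢ t
  lastTile-rank-maximal t'∈ lt refl = <-irrefl rank-lastTile (<-≤-trans lt (tile-rank-≤ t'∈))

  no-antidiagonal-tiles : ∀ {x y} → Tile (x , suc y) → Tile (suc x , y) → ⊥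
  no-antidiagonal-tiles {x} {y} t₁ t₂ =
    1+n≢n (sym (cong proj₁ (tile-rank-injective t₁ t₂ (+-suc x y))))

  edge⇒tile : ∀ {e} → IsEdge ds e → ∃ λ t → Tile t × e ∈ sides t
  edge⇒tile e∈ = find (∈ₚ.∈-concatMap⁻ sides e∈)

  side⇒edge : ∀ {t e} → Tile t → e ∈ sides t → IsEdge ds e
  side⇒edge t∈ e∈ = ∈ₚ.∈-concatMap⁺ sides (lose t∈ e∈)

  corner⇒vertex : ∀ {t v} → Tile t → v ∈ corners t → IsVertex ds v
  corner⇒vertex t∈ v∈ = ∈ₚ.∈-concatMap⁺ corners (lose t∈ v∈)

  hor-edge⇒tile : ∀ {x y} → IsEdge ds (hor x y) →
                  Tile (x , y) ⊎ ∃ λ y' → y ≡ suc y' × Tile (x , y')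
  hor-edge⇒tile e∈ with edge⇒tile e∈
  ... | t , t∈ , s∈ with hor∈sides s∈
  ...   | inj₁ refl               = inj₁ t∈
  ...   | inj₂ (y' , refl , refl) = inj₂ (y' , refl , t∈)

  ver-edge⇒tile : ∀ {x y} → IsEdge ds (ver x y) →
                  Tile (x , y) ⊎ ∃ λ x' → x ≡ suc x' × Tile (x' , y)
  ver-edge⇒tile e∈ with edge⇒tile e∈
  ... | t , t∈ , s∈ with ver∈sides s∈
  ...   | inj₁ refl               = inj₁ t∈
  ...   | inj₂ (x' , refl , refl) = inj₂ (x' , refl , t∈)

  only-tile⇒outer : ∀ {e t} → Tile t → e ∈ sides t →
                    (∀ {t'} → Tile t' → e ∈ sides t' → t' ≡ t) → OnOuterFace ds e
  only-tile⇒outer {e} t∈ e∈ only =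
    ∈ₚ.∈-filter⁺ (λ e → tileCount ds e ≟ 1) (side⇒edge t∈ e∈)
      (length-filter≡1 (λ t → e ME.∈? sides t) (tilesFrom-unique (0 , 0) ds) t∈ e∈ only)

  bottom-outer : ∀ {x y} → Tile (x , y) → (∀ {y'} → y ≡ suc y' → ¬ Tile (x , y')) →
                 OnOuterFace ds (hor x y)
  bottom-outer {x} {y} t∈ nothing-below = only-tile⇒outer t∈ bottom∈ only
    where
    only : ∀ {t} → Tile t → hor x y ∈ sides t → t ≡ (x , y)
    only t∈ s∈ with hor∈sides s∈
    ... | inj₁ eq                = eq
    ... | inj₂ (_ , refl , refl) = ⊥-elim (nothing-below refl t∈)

  top-outer : ∀ {x y} → Tile (x , y) → ¬ Tile (x , suc y) → OnOuterFace ds (hor x (suc y))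
  top-outer {x} {y} t∈ nothing-above = only-tile⇒outer t∈ top∈ only
    where
    only : ∀ {t} → Tile t → hor x (suc y) ∈ sides t → t ≡ (x , y)
    only t∈ s∈ with hor∈sides s∈
    ... | inj₁ refl              = ⊥-elim (nothing-above t∈)
    ... | inj₂ (_ , refl , refl) = refl

  left-outer : ∀ {x y} → Tile (x , y) → (∀ {x'} → x ≡ suc x' → ¬ Tile (x' , y)) →
               OnOuterFace ds (ver x y)
  left-outer {x} {y} t∈ nothing-left = only-tile⇒outer t∈ left∈ only
    where
    only : ∀ {t} → Tile t → ver x y ∈ sides t → t ≡ (x , y)
    only t∈ s∈ with ver∈sides s∈
    ... | inj₁ eq                = eq
    ... | inj₂ (_ , refl , refl) = ⊥-elim (nothing-left refl t∈)

  right-outer : ∀ {x y} → Tile (x , y) → ¬ Tile (suc x , y) → OnOuterFace ds (ver (suc x) y)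
  right-outer {x} {y} t∈ nothing-right = only-tile⇒outer t∈ right∈ only
    where
    only : ∀ {t} → Tile t → ver (suc x) y ∈ sides t → t ≡ (x , y)
    only t∈ s∈ with ver∈sides s∈
    ... | inj₁ refl              = ⊥-elim (nothing-right t∈)
    ... | inj₂ (_ , refl , refl) = refl

  Adjacent : Point → Point → Set
  Adjacent p q = ∃ λ e → Step p q e × IsEdge ds e

  B≡0⊎adjacent : ∀ w p q → B ds w p q ≡ 0ℤ ⊎ Adjacent p q
  B≡0⊎adjacent w p q with edgeBetween p q in eq
  ... | nothing = inj₁ refl
  ... | just e with e ME.∈? edgeList ds
  ...   | yes e∈ = inj₂ (e , edgeBetween⇒Step p q eq , e∈)
  ...   | no _   = inj₁ refl

  B-product≡0⊎adjacent : ∀ w i j k →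
                         B ds w i k ℤ.* B ds w j k ≡ 0ℤ ⊎ Adjacent i k × Adjacent j k
  B-product≡0⊎adjacent w i j k with B≡0⊎adjacent w i k | B≡0⊎adjacent w j k
  ... | inj₁ B≡0 | _        = inj₁ (cong (ℤ._* B ds w j k) B≡0)
  ... | inj₂ _   | inj₁ B≡0 =
    inj₁ (trans (cong (B ds w i k ℤ.*_) B≡0) (ℤₚ.*-zeroʳ (B ds w i k)))
  ... | inj₂ a   | inj₂ b   = inj₂ (a , b)

  B-product≡0-outside : ∀ w {i j k a b} → (∀ {e₁ e₂} → Step i k e₁ → Step j k e₂ → k ≡ a ⊎ k ≡ b) →
                        k ≢ a → k ≢ b → B ds w i k ℤ.* B ds w j k ≡ 0ℤ
  B-product≡0-outside w {i} {j} {k} common k≢a k≢b with B-product≡0⊎adjacent w i j k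
  ... | inj₁ product≡0                      = product≡0
  ... | inj₂ ((_ , s₁ , _) , (_ , s₂ , _)) = [ ⊥-elim ∘ k≢a , ⊥-elim ∘ k≢b ]′ (common s₁ s₂)

  B-step : ∀ w {p q e} → Step p q e → IsEdge ds e → B ds w p q ≡ signℤ (w e)
  B-step w {e = e} s e∈ rewrite Step⇒edgeBetween s | dec-true (e ME.∈? edgeList ds) e∈ = refl

  adjᵇ-step : ∀ {p q e} → Step p q e → IsEdge ds e → adjᵇ ds p q ≡ true
  adjᵇ-step {e = e} s e∈ rewrite Step⇒edgeBetween s = dec-true (e ME.∈? edgeList ds) e∈

  diagonal-tiles⇒turn : ∀ {x y} → Tile (x , y) → Tile (suc x , suc y) → IsTurn ds (suc x , suc y)
  diagonal-tiles⇒turn {x} {y} sw ne = corner⇒vertex ne lowerLeft∈ , inj₂ degree≡4 , not-excluded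
    where
    degree≡4 : degree ds (suc x , suc y) ≡ 4
    degree≡4
      rewrite adjᵇ-step east  (side⇒edge ne bottom∈)
            | adjᵇ-step north (side⇒edge ne left∈)
            | adjᵇ-step west  (side⇒edge sw top∈)
            | adjᵇ-step south (side⇒edge sw right∈)
            = refl
    not-excluded : ¬ Excluded ds (suc x , suc y)
    not-excluded (inj₁ ())
    not-excluded (inj₂ (inj₁ ()))
    not-excluded (inj₂ (inj₂ (inj₁ ())))
    not-excluded (inj₂ (inj₂ (inj₂ at-end))) =
      <-irrefl rank-lastTile
        (<-≤-trans (rank-upper-or-right-corner (lastTile ds) at-end) (tile-rank-≤ ne))

  lowerRight-elbow⇒tile : ∀ {x y} → IsEdge ds (hor x y) → IsEdge ds (ver (suc x) y) →
                          ¬ IsTurn ds (suc x , y) → Tile (x , y)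
  lowerRight-elbow⇒tile l u ¬turn with hor-edge⇒tile l | ver-edge⇒tile u
  ... | inj₁ t∈              | _                    = t∈
  ... | _                    | inj₂ (_ , refl , t∈) = t∈
  ... | inj₂ (_ , refl , sw) | inj₁ ne              = ⊥-elim (¬turn (diagonal-tiles⇒turn sw ne))

  upperLeft-elbow⇒tile : ∀ {x y} → IsEdge ds (hor x (suc y)) → IsEdge ds (ver x y) →
                         ¬ IsTurn ds (x , suc y) → Tile (x , y)
  upperLeft-elbow⇒tile r d ¬turn with hor-edge⇒tile r | ver-edge⇒tile d
  ... | inj₂ (_ , refl , t∈) | _                    = t∈
  ... | _                    | inj₁ t∈              = t∈
  ... | inj₁ ne              | inj₂ (_ , refl , sw) = ⊥-elim (¬turn (diagonal-tiles⇒turn sw ne))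

  upperRight-elbow⇒tile : ∀ {x y} → IsEdge ds (hor x (suc y)) → IsEdge ds (ver (suc x) y) →
                          Tile (x , y)
  upperRight-elbow⇒tile l d with hor-edge⇒tile l | ver-edge⇒tile d
  ... | inj₂ (_ , refl , t∈) | _                    = t∈
  ... | _                    | inj₂ (_ , refl , t∈) = t∈
  ... | inj₁ nw              | inj₁ se              = ⊥-elim (no-antidiagonal-tiles nw se)

  lowerLeft-elbow⇒tile : ∀ {x y} → IsEdge ds (hor x y) → IsEdge ds (ver x y) → Tile (x , y)
  lowerLeft-elbow⇒tile r u with hor-edge⇒tile r | ver-edge⇒tile u
  ... | inj₁ t∈              | _                    = t∈
  ... | _                    | inj₁ t∈              = t∈
  ... | inj₂ (_ , refl , se) | inj₂ (_ , refl , nw) = ⊥-elim (no-antidiagonal-tiles nw se)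

-- Boundary paths

startEdge-shape : ∀ d ds {e} → IsStartEdge (d ∷ ds) e →
                  (d ≡ R × e ≡ ver 0 0) ⊎ (d ≡ U × e ≡ hor 0 0)
startEdge-shape R ds (bottom∈ , _ , ∉₂) = ⊥-elim (∉₂ lowerLeft∈)
startEdge-shape R ds (top∈    , _ , ∉₂) = ⊥-elim (∉₂ upperLeft∈)
startEdge-shape R ds (left∈   , _ , _ ) = inj₁ (refl , refl)
startEdge-shape R ds (right∈  , ∉₁ , _) = ⊥-elim (∉₁ lowerLeft∈)
startEdge-shape U ds (bottom∈ , _ , _ ) = inj₂ (refl , refl)
startEdge-shape U ds (top∈    , ∉₁ , _) = ⊥-elim (∉₁ lowerLeft∈)
startEdge-shape U ds (left∈   , _ , ∉₂) = ⊥-elim (∉₂ lowerLeft∈)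
startEdge-shape U ds (right∈  , _ , ∉₂) = ⊥-elim (∉₂ lowerRight∈)

far-side-shape : ∀ x y d {e} → e ∈ sides (step (x , y) d) →
                 ¬ proj₁ (ends e) ∈ corners (x , y) → ¬ proj₂ (ends e) ∈ corners (x , y) →
                 (d ≡ R × e ≡ ver (suc (suc x)) y) ⊎ (d ≡ U × e ≡ hor x (suc (suc y)))
far-side-shape x y R bottom∈ ∉ _ = ⊥-elim (∉ lowerRight∈)
far-side-shape x y R top∈    ∉ _ = ⊥-elim (∉ upperRight∈)
far-side-shape x y R left∈   ∉ _ = ⊥-elim (∉ lowerRight∈)
far-side-shape x y R right∈  _ _ = inj₁ (refl , refl)
far-side-shape x y U bottom∈ ∉ _ = ⊥-elim (∉ upperLeft∈)
far-side-shape x y U top∈    _ _ = inj₂ (refl , refl)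
far-side-shape x y U left∈   ∉ _ = ⊥-elim (∉ upperLeft∈)
far-side-shape x y U right∈  ∉ _ = ⊥-elim (∉ upperRight∈)

endEdge-shape : ∀ d ds {e} → IsEndEdge (d ∷ ds) e →
  (∃ λ x → ∃ λ y → e ≡ ver (suc (suc x)) y ×
                   Snake.Tile (d ∷ ds) (x , y) × lastTile (d ∷ ds) ≡ (suc x , y)) ⊎
  (∃ λ x → ∃ λ y → e ≡ hor x (suc (suc y)) ×
                   Snake.Tile (d ∷ ds) (x , y) × lastTile (d ∷ ds) ≡ (x , suc y))
endEdge-shape d ds {e} (e∈ , ∉₁ , ∉₂)
  with lastTileFrom-step-penult (0 , 0) d ds | penultTileFrom-∈ (0 , 0) d ds
... | d' , last≡ | penult∈ with penultTileFrom (0 , 0) (d ∷ ds)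
...   | (x , y) with far-side-shape x y d' (subst (λ t → e ∈ sides t) last≡ e∈) ∉₁ ∉₂
...     | inj₁ (refl , refl) = inj₁ (x , y , refl , penult∈ , last≡)
...     | inj₂ (refl , refl) = inj₂ (x , y , refl , penult∈ , last≡)

module _ (d : Dir) (ds : List Dir) where
  open Snake (d ∷ ds)

  second-tile : Tile (step (0 , 0) d)
  second-tile = there (tilesFrom-head (step (0 , 0) d) ds)

  bottom-path-edges : ∀ {x y} → Tile (x , y) → Tile (suc x , y) →
                      (∀ {y'} → y ≡ suc y' → ¬ Tile (x , y')) →
                      IsPathEdge (d ∷ ds) (hor x y) × IsPathEdge (d ∷ ds) (hor (suc x) y)
  bottom-path-edges {x} {y} t₁ t₂ nothing-below =
    (bottom-outer t₁ nothing-below , left-not-start , left-not-end) ,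
    (bottom-outer t₂ (λ { refl se → no-antidiagonal-tiles t₁ se }) , right-not-start , right-not-end)
    where
    left-not-start : ¬ IsStartEdge (d ∷ ds) (hor x y)
    left-not-start start with startEdge-shape d ds start
    ... | inj₂ (refl , refl) with () ← tile-rank-injective t₂ second-tile refl
    left-not-end : ¬ IsEndEdge (d ∷ ds) (hor x y)
    left-not-end end with endEdge-shape d ds end
    ... | inj₂ (_ , _ , refl , _ , last≡) = nothing-below refl (lastTile≡⇒tile last≡)
    right-not-start : ¬ IsStartEdge (d ∷ ds) (hor (suc x) y)
    right-not-start start with startEdge-shape d ds start
    ... | inj₁ (_ , ())
    ... | inj₂ (_ , ())
    right-not-end : ¬ IsEndEdge (d ∷ ds) (hor (suc x) y)
    right-not-end end with endEdge-shape d ds end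
    ... | inj₂ (_ , _ , refl , _ , last≡) = no-antidiagonal-tiles t₁ (lastTile≡⇒tile last≡)

  top-path-edges : ∀ {x y} → Tile (x , y) → Tile (suc x , y) → ¬ Tile (suc x , suc y) →
                   IsPathEdge (d ∷ ds) (hor x (suc y)) × IsPathEdge (d ∷ ds) (hor (suc x) (suc y))
  top-path-edges {x} {y} t₁ t₂ ¬ne =
    (top-outer t₁ (λ nw → no-antidiagonal-tiles nw t₂) , not-start , left-not-end) ,
    (top-outer t₂ ¬ne , not-start , right-not-end)
    where
    not-start : ∀ {x'} → ¬ IsStartEdge (d ∷ ds) (hor x' (suc y))
    not-start start with startEdge-shape d ds start
    ... | inj₁ (_ , ())
    ... | inj₂ (_ , ())
    left-not-end : ¬ IsEndEdge (d ∷ ds) (hor x (suc y))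
    left-not-end end with endEdge-shape d ds end
    ... | inj₂ (_ , _ , refl , _ , last≡) = lastTile-rank-maximal t₂ ≤-refl last≡
    right-not-end : ¬ IsEndEdge (d ∷ ds) (hor (suc x) (suc y))
    right-not-end end with endEdge-shape d ds end
    ... | inj₂ (_ , y' , refl , penult , _) with () ← tile-rank-injective penult t₁ (sym (+-suc x y'))

  left-path-edges : ∀ {x y} → Tile (x , y) → Tile (x , suc y) →
                    (∀ {x'} → x ≡ suc x' → ¬ Tile (x' , y)) →
                    IsPathEdge (d ∷ ds) (ver x y) × IsPathEdge (d ∷ ds) (ver x (suc y))
  left-path-edges {x} {y} t₁ t₂ nothing-left =
    (left-outer t₁ nothing-left , lower-not-start , lower-not-end) ,
    (left-outer t₂ (λ { refl nw → no-antidiagonal-tiles nw t₁ }) , upper-not-start , upper-not-end)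
    where
    lower-not-start : ¬ IsStartEdge (d ∷ ds) (ver x y)
    lower-not-start start with startEdge-shape d ds start
    ... | inj₁ (refl , refl) with () ← tile-rank-injective t₂ second-tile refl
    lower-not-end : ¬ IsEndEdge (d ∷ ds) (ver x y)
    lower-not-end end with endEdge-shape d ds end
    ... | inj₁ (_ , _ , refl , _ , last≡) = nothing-left refl (lastTile≡⇒tile last≡)
    upper-not-start : ¬ IsStartEdge (d ∷ ds) (ver x (suc y))
    upper-not-start start with startEdge-shape d ds start
    ... | inj₁ (_ , ())
    ... | inj₂ (_ , ())
    upper-not-end : ¬ IsEndEdge (d ∷ ds) (ver x (suc y))
    upper-not-end end with endEdge-shape d ds end
    ... | inj₁ (_ , _ , refl , _ , last≡) = no-antidiagonal-tiles (lastTile≡⇒tile last≡) t₁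

  right-path-edges : ∀ {x y} → Tile (x , y) → Tile (x , suc y) → ¬ Tile (suc x , suc y) →
                     IsPathEdge (d ∷ ds) (ver (suc x) y) × IsPathEdge (d ∷ ds) (ver (suc x) (suc y))
  right-path-edges {x} {y} t₁ t₂ ¬ne =
    (right-outer t₁ (λ se → no-antidiagonal-tiles t₂ se) , not-start , lower-not-end) ,
    (right-outer t₂ ¬ne , not-start , upper-not-end)
    where
    not-start : ∀ {y'} → ¬ IsStartEdge (d ∷ ds) (ver (suc x) y')
    not-start start with startEdge-shape d ds start
    ... | inj₁ (_ , ())
    ... | inj₂ (_ , ())
    lower-not-end : ¬ IsEndEdge (d ∷ ds) (ver (suc x) y)
    lower-not-end end with endEdge-shape d ds end
    ... | inj₁ (_ , _ , refl , _ , last≡) =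
      lastTile-rank-maximal t₂ (≤-reflexive (sym (+-suc x y))) last≡
    upper-not-end : ¬ IsEndEdge (d ∷ ds) (ver (suc x) (suc y))
    upper-not-end end with endEdge-shape d ds end
    ... | inj₁ (x' , _ , refl , penult , _) with () ← tile-rank-injective penult t₁ (+-suc x' y)

  horizontal-straight : ∀ {x y} → IsEdge (d ∷ ds) (hor x y) → IsEdge (d ∷ ds) (hor (suc x) y) →
    IsTurn (d ∷ ds) (suc x , y) ⊎
    IsPathEdge (d ∷ ds) (hor x y) × IsPathEdge (d ∷ ds) (hor (suc x) y)
  horizontal-straight l r with hor-edge⇒tile l | hor-edge⇒tile r
  ... | inj₂ (_ , refl , sw) | inj₁ ne              = inj₁ (diagonal-tiles⇒turn sw ne)
  ... | inj₁ nw              | inj₂ (_ , refl , se) = ⊥-elim (no-antidiagonal-tiles nw se)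
  horizontal-straight {x} l r | inj₂ (y , refl , sw) | inj₂ (_ , refl , se)
    with tile? (suc x , suc y)
  ... | yes ne = inj₁ (diagonal-tiles⇒turn sw ne)
  ... | no ¬ne = inj₂ (top-path-edges sw se ¬ne)
  horizontal-straight {x} {zero}  l r | inj₁ t₁ | inj₁ t₂ = inj₂ (bottom-path-edges t₁ t₂ λ ())
  horizontal-straight {x} {suc y} l r | inj₁ t₁ | inj₁ t₂ with tile? (x , y)
  ... | yes sw = inj₁ (diagonal-tiles⇒turn sw t₂)
  ... | no ¬sw = inj₂ (bottom-path-edges t₁ t₂ λ { refl → ¬sw })

  vertical-straight : ∀ {x y} → IsEdge (d ∷ ds) (ver x y) → IsEdge (d ∷ ds) (ver x (suc y)) →
    IsTurn (d ∷ ds) (x , suc y) ⊎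
    IsPathEdge (d ∷ ds) (ver x y) × IsPathEdge (d ∷ ds) (ver x (suc y))
  vertical-straight lo up with ver-edge⇒tile lo | ver-edge⇒tile up
  ... | inj₂ (_ , refl , sw) | inj₁ ne              = inj₁ (diagonal-tiles⇒turn sw ne)
  ... | inj₁ se              | inj₂ (_ , refl , nw) = ⊥-elim (no-antidiagonal-tiles nw se)
  vertical-straight {y = y} lo up | inj₂ (x , refl , sw) | inj₂ (_ , refl , nw)
    with tile? (suc x , suc y)
  ... | yes ne = inj₁ (diagonal-tiles⇒turn sw ne)
  ... | no ¬ne = inj₂ (right-path-edges sw nw ¬ne)
  vertical-straight {zero}      lo up | inj₁ t₁ | inj₁ t₂ = inj₂ (left-path-edges t₁ t₂ λ ())
  vertical-straight {suc x} {y} lo up | inj₁ t₁ | inj₁ t₂ with tile? (x , y)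
  ... | yes sw = inj₁ (diagonal-tiles⇒turn sw t₂)
  ... | no ¬sw = inj₂ (left-path-edges t₁ t₂ λ { refl → ¬sw })

-- Common neighbours of an upper and a lower boundary vertex

OnOppositeBoundaries : List Dir → Point → Point → Set
OnOppositeBoundaries ds i j =
  OnUpperBoundary ds i × OnLowerBoundary ds j ⊎ OnUpperBoundary ds j × OnLowerBoundary ds i

upper-boundary-[] : ∀ {i} → OnUpperBoundary [] i → proj₂ i ≡ 1
upper-boundary-[] (inj₁ refl) = refl
upper-boundary-[] (inj₂ refl) = refl

lower-boundary-[] : ∀ {j} → OnLowerBoundary [] j → proj₂ j ≡ 0
lower-boundary-[] (inj₁ refl) = refl
lower-boundary-[] (inj₂ refl) = refl

upper≢lower : ∀ ds {i j} → OnUpperBoundary ds i → OnLowerBoundary ds j → i ≢ j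
upper≢lower []       u l refl with () ← trans (sym (upper-boundary-[] u)) (lower-boundary-[] l)
upper≢lower (U ∷ ds) u (_ , ¬reach) refl = ¬reach u
upper≢lower (R ∷ ds) (_ , ¬reach) l refl = ¬reach l

opposite-boundaries⇒≢ : ∀ ds {i j} → OnOppositeBoundaries ds i j → i ≢ j
opposite-boundaries⇒≢ ds (inj₁ (u , l)) = upper≢lower ds u l
opposite-boundaries⇒≢ ds (inj₂ (u , l)) = ≢-sym (upper≢lower ds u l)

PathReach-two-steps : ∀ {ds a i k j e₁ e₂} → PathReach ds a i → IsPathEdge ds e₁ → IsPathEdge ds e₂ →
                      Joins e₁ i k → Joins e₂ k j → PathReach ds a j
PathReach-two-steps reach p₁ p₂ J₁ J₂ = next _ (next _ reach p₁ J₁) p₂ J₂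

two-path-edges⇒¬opposite : ∀ d ds {i k j e₁ e₂} → IsPathEdge (d ∷ ds) e₁ → IsPathEdge (d ∷ ds) e₂ →
                           Joins e₁ i k → Joins e₂ k j → ¬ OnOppositeBoundaries (d ∷ ds) i j
two-path-edges⇒¬opposite U ds p₁ p₂ J₁ J₂ (inj₁ (reach , _ , ¬reach)) =
  ¬reach (PathReach-two-steps reach p₁ p₂ J₁ J₂)
two-path-edges⇒¬opposite U ds p₁ p₂ J₁ J₂ (inj₂ (reach , _ , ¬reach)) =
  ¬reach (PathReach-two-steps reach p₂ p₁ (Joins-sym J₂) (Joins-sym J₁))
two-path-edges⇒¬opposite R ds p₁ p₂ J₁ J₂ (inj₁ ((_ , ¬reach) , reach)) =
  ¬reach (PathReach-two-steps reach p₂ p₁ (Joins-sym J₂) (Joins-sym J₁))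
two-path-edges⇒¬opposite R ds p₁ p₂ J₁ J₂ (inj₂ ((_ , ¬reach) , reach)) =
  ¬reach (PathReach-two-steps reach p₁ p₂ J₁ J₂)

horizontal-non-turn⇒¬opposite : ∀ ds {x y} → IsEdge ds (hor x y) → IsEdge ds (hor (suc x) y) →
  ¬ IsTurn ds (suc x , y) → ¬ OnOppositeBoundaries ds (x , y) (suc (suc x) , y)
horizontal-non-turn⇒¬opposite [] _ _ _ (inj₁ (u , l))
  with () ← trans (sym (upper-boundary-[] u)) (lower-boundary-[] l)
horizontal-non-turn⇒¬opposite [] _ _ _ (inj₂ (u , l))
  with () ← trans (sym (upper-boundary-[] u)) (lower-boundary-[] l)
horizontal-non-turn⇒¬opposite (d ∷ ds) l r ¬turn opp with horizontal-straight d ds l r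
... | inj₁ turn      = ¬turn turn
... | inj₂ (p₁ , p₂) =
  two-path-edges⇒¬opposite d ds p₁ p₂ (Step⇒Joins east) (Step⇒Joins east) opp

vertical-non-turn⇒¬opposite : ∀ ds {x y} → IsEdge ds (ver x y) → IsEdge ds (ver x (suc y)) →
  ¬ IsTurn ds (x , suc y) → ¬ OnOppositeBoundaries ds (x , y) (x , suc (suc y))
vertical-non-turn⇒¬opposite [] _ _ _ (inj₁ (_ , l)) with () ← lower-boundary-[] l
vertical-non-turn⇒¬opposite [] _ _ _ (inj₂ (u , _)) with () ← upper-boundary-[] u
vertical-non-turn⇒¬opposite (d ∷ ds) lo up ¬turn opp with vertical-straight d ds lo up
... | inj₁ turn      = ¬turn turn
... | inj₂ (p₁ , p₂) =
  two-path-edges⇒¬opposite d ds p₁ p₂ (Step⇒Joins north) (Step⇒Joins north) opp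

data OppositeCorners (ds : List Dir) : Point → Point → Set where
  sw-ne : ∀ {x y} → Snake.Tile ds (x , y) → OppositeCorners ds (x , y) (suc x , suc y)
  ne-sw : ∀ {x y} → Snake.Tile ds (x , y) → OppositeCorners ds (suc x , suc y) (x , y)
  se-nw : ∀ {x y} → Snake.Tile ds (x , y) → OppositeCorners ds (suc x , y) (x , suc y)
  nw-se : ∀ {x y} → Snake.Tile ds (x , y) → OppositeCorners ds (x , suc y) (suc x , y)

module _ (ds : List Dir) where
  open Snake ds

  common-neighbour⇒opposite-corners :
    ∀ {i j k e₁ e₂} → Step i k e₁ → Step j k e₂ → IsEdge ds e₁ → IsEdge ds e₂ →
    ¬ IsTurn ds k → OnOppositeBoundaries ds i j → OppositeCorners ds i j
  common-neighbour⇒opposite-corners east  east  _ _ _ opp = ⊥-elim (opposite-boundaries⇒≢ ds opp refl)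
  common-neighbour⇒opposite-corners west  west  _ _ _ opp = ⊥-elim (opposite-boundaries⇒≢ ds opp refl)
  common-neighbour⇒opposite-corners north north _ _ _ opp = ⊥-elim (opposite-boundaries⇒≢ ds opp refl)
  common-neighbour⇒opposite-corners south south _ _ _ opp = ⊥-elim (opposite-boundaries⇒≢ ds opp refl)
  common-neighbour⇒opposite-corners east  west  l r ¬turn opp =
    ⊥-elim (horizontal-non-turn⇒¬opposite ds l r ¬turn opp)
  common-neighbour⇒opposite-corners west  east  r l ¬turn opp =
    ⊥-elim (horizontal-non-turn⇒¬opposite ds l r ¬turn (swap opp))
  common-neighbour⇒opposite-corners north south lo up ¬turn opp =
    ⊥-elim (vertical-non-turn⇒¬opposite ds lo up ¬turn opp)
  common-neighbour⇒opposite-corners south north up lo ¬turn opp =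
    ⊥-elim (vertical-non-turn⇒¬opposite ds lo up ¬turn (swap opp))
  common-neighbour⇒opposite-corners east  south h v ¬turn _ = sw-ne (lowerRight-elbow⇒tile h v ¬turn)
  common-neighbour⇒opposite-corners south east  v h ¬turn _ = ne-sw (lowerRight-elbow⇒tile h v ¬turn)
  common-neighbour⇒opposite-corners north west  v h ¬turn _ = sw-ne (upperLeft-elbow⇒tile h v ¬turn)
  common-neighbour⇒opposite-corners west  north h v ¬turn _ = ne-sw (upperLeft-elbow⇒tile h v ¬turn)
  common-neighbour⇒opposite-corners east  north h v _ _     = nw-se (upperRight-elbow⇒tile h v)
  common-neighbour⇒opposite-corners north east  v h _ _     = se-nw (upperRight-elbow⇒tile h v)
  common-neighbour⇒opposite-corners west  south h v _ _     = se-nw (lowerLeft-elbow⇒tile h v)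
  common-neighbour⇒opposite-corners south west  v h _ _     = nw-se (lowerLeft-elbow⇒tile h v)

-- Kasteleyn weights and the entries of BBᵀ

odd-minus⇒cancel : ∀ bottom top left right →
  length (filterᵇ isMinus (bottom ∷ top ∷ left ∷ right ∷ [])) % 2 ≡ 1 →
  signℤ bottom ℤ.* signℤ right ℤ.+ signℤ left ℤ.* signℤ top ≡ 0ℤ ×
  signℤ bottom ℤ.* signℤ left ℤ.+ signℤ right ℤ.* signℤ top ≡ 0ℤ
odd-minus⇒cancel plus  plus  plus  plus  ()
odd-minus⇒cancel plus  plus  plus  minus _  = refl , refl
odd-minus⇒cancel plus  plus  minus plus  _  = refl , refl
odd-minus⇒cancel plus  plus  minus minus ()
odd-minus⇒cancel plus  minus plus  plus  _  = refl , refl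
odd-minus⇒cancel plus  minus plus  minus ()
odd-minus⇒cancel plus  minus minus plus  ()
odd-minus⇒cancel plus  minus minus minus _  = refl , refl
odd-minus⇒cancel minus plus  plus  plus  _  = refl , refl
odd-minus⇒cancel minus plus  plus  minus ()
odd-minus⇒cancel minus plus  minus plus  ()
odd-minus⇒cancel minus plus  minus minus _  = refl , refl
odd-minus⇒cancel minus minus plus  plus  ()
odd-minus⇒cancel minus minus plus  minus _  = refl , refl
odd-minus⇒cancel minus minus minus plus  _  = refl , refl
odd-minus⇒cancel minus minus minus minus ()

kasteleyn-tile-cancel : ∀ ds w {x y} → Kasteleyn ds w → Snake.Tile ds (x , y) →
  let bottom = signℤ (w (hor x y)); top   = signℤ (w (hor x (suc y)))
      left   = signℤ (w (ver x y)); right = signℤ (w (ver (suc x) y))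
  in bottom ℤ.* right ℤ.+ left ℤ.* top ≡ 0ℤ × bottom ℤ.* left ℤ.+ right ℤ.* top ≡ 0ℤ
kasteleyn-tile-cancel ds w {x} {y} kasteleyn t∈ =
  odd-minus⇒cancel (w (hor x y)) (w (hor x (suc y))) (w (ver x y)) (w (ver (suc x) y))
    (subst (λ n → n % 2 ≡ 1) (length-filterᵇ-∘ isMinus w (sides (x , y)))
      -- `there` skips the outer face; `refl` says that a tile is bounded by a 4-cycle.
      (proj₁ (All.lookup kasteleyn (there (∈ₚ.∈-map⁺ sides t∈))) refl))

corner-≤ : ∀ {x y v} → v ∈ corners (x , y) → proj₁ v ≤ suc x × proj₂ v ≤ suc y
corner-≤ {x} {y} lowerLeft∈  = n≤1+n x , n≤1+n y
corner-≤ {x} {y} lowerRight∈ = ≤-refl , n≤1+n y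
corner-≤ {x} {y} upperLeft∈  = n≤1+n x , ≤-refl
corner-≤         upperRight∈ = ≤-refl , ≤-refl

white-of-black-neighbour : ∀ {a b : Colour} → a ≡ black → a ≢ b → b ≡ white
white-of-black-neighbour {b = black} refl a≢b = ⊥-elim (a≢b refl)
white-of-black-neighbour {b = white} _    _   = refl

module _ (ds : List Dir) (col : Point → Colour) where
  open Snake ds

  whiteVertices-unique : Unique (whiteVertices ds col)
  whiteVertices-unique =
    Uniqueₚ.filter⁺ (λ p → col p ≟C white)
      (Uniqueₚ.filter⁺ (λ p → p MP.∈? vertexList ds)
        (Uniqueₚ.cartesianProduct⁺ (Uniqueₚ.upTo⁺ (suc (numTiles ds)))
                                   (Uniqueₚ.upTo⁺ (suc (numTiles ds)))))

  whiteVertices-white : ∀ {k} → k ∈ whiteVertices ds col → col k ≡ white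
  whiteVertices-white k∈ =
    proj₂ (∈ₚ.∈-filter⁻ (λ p → col p ≟C white)
                        {xs = filter (λ p → p MP.∈? vertexList ds) (box ds)} k∈)

  corner∈box : ∀ {x y v} → Tile (x , y) → v ∈ corners (x , y) → v ∈ box ds
  corner∈box {x} {y} t∈ v∈ with corner-≤ v∈
  ... | a≤ , b≤ = ∈ₚ.∈-cartesianProduct⁺
                    (in-range (≤-trans a≤ (s≤s (≤-trans (m≤m+n x y) (tile-rank-≤ t∈)))))
                    (in-range (≤-trans b≤ (s≤s (≤-trans (m≤n+m y x) (tile-rank-≤ t∈)))))
    where
    in-range : ∀ {c} → c ≤ suc (length ds) → c ∈ upTo (suc (numTiles ds))
    in-range c≤ = ∈ₚ.∈-upTo⁺ (s≤s c≤)

  white-corner∈whiteVertices : ∀ {x y v} → Tile (x , y) → v ∈ corners (x , y) → col v ≡ white →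
                               v ∈ whiteVertices ds col
  white-corner∈whiteVertices t∈ v∈ v-white =
    ∈ₚ.∈-filter⁺ (λ p → col p ≟C white)
      (∈ₚ.∈-filter⁺ (λ p → p MP.∈? vertexList ds) (corner∈box t∈ v∈) (corner⇒vertex t∈ v∈)) v-white

module _ (ds : List Dir) (col : Point → Colour) (w : Edge → Sign) where
  open Snake ds

  BBᵀ-sym : ∀ i j → BBᵀ ds col w i j ≡ BBᵀ ds col w j i
  BBᵀ-sym i j =
    cong sumℤ (Listₚ.map-cong (λ k → ℤₚ.*-comm (B ds w i k) (B ds w j k)) (whiteVertices ds col))

  module _ (proper : ProperColouring ds col) (kasteleyn : Kasteleyn ds w) where

    BBᵀ-diagonal≡0 : ∀ {x y} → Tile (x , y) → col (x , y) ≡ black →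
                     BBᵀ ds col w (x , y) (suc x , suc y) ≡ 0ℤ
    BBᵀ-diagonal≡0 {x} {y} t∈ black-ll = begin
      sumℤ (map term (whiteVertices ds col))
        ≡⟨ sumℤ-pair term (whiteVertices ds col) (whiteVertices-unique ds col) lr∈ ul∈ lr≢ul vanish ⟩
      term (suc x , y) ℤ.+ term (x , suc y)
        ≡⟨ cong₂ ℤ._+_ (cong₂ ℤ._*_ (B-step w east  bottom) (B-step w south right))
                       (cong₂ ℤ._*_ (B-step w north left)   (B-step w west  top)) ⟩
      signℤ (w (hor x y)) ℤ.* signℤ (w (ver (suc x) y)) ℤ.+
      signℤ (w (ver x y)) ℤ.* signℤ (w (hor x (suc y)))
        ≡⟨ proj₁ (kasteleyn-tile-cancel ds w kasteleyn t∈) ⟩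
      0ℤ ∎
      where
      open ≡-Reasoning
      term : Point → ℤ.ℤ
      term k = B ds w (x , y) k ℤ.* B ds w (suc x , suc y) k
      bottom : IsEdge ds (hor x y)
      bottom = side⇒edge t∈ bottom∈
      top : IsEdge ds (hor x (suc y))
      top = side⇒edge t∈ top∈
      left : IsEdge ds (ver x y)
      left = side⇒edge t∈ left∈
      right : IsEdge ds (ver (suc x) y)
      right = side⇒edge t∈ right∈
      lr∈ : (suc x , y) ∈ whiteVertices ds col
      lr∈ = white-corner∈whiteVertices ds col t∈ lowerRight∈
              (white-of-black-neighbour black-ll (proper _ bottom))
      ul∈ : (x , suc y) ∈ whiteVertices ds col
      ul∈ = white-corner∈whiteVertices ds col t∈ upperLeft∈
              (white-of-black-neighbour black-ll (proper _ left))
      lr≢ul : (suc x , y) ≢ (x , suc y)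
      lr≢ul eq = 1+n≢n (cong proj₁ eq)
      vanish : ∀ {k} → k ∈ whiteVertices ds col → k ≢ (suc x , y) → k ≢ (x , suc y) → term k ≡ 0ℤ
      vanish _ = B-product≡0-outside w diagonal-common-neighbour

    BBᵀ-antidiagonal≡0 : ∀ {x y} → Tile (x , y) → col (suc x , y) ≡ black →
                         BBᵀ ds col w (suc x , y) (x , suc y) ≡ 0ℤ
    BBᵀ-antidiagonal≡0 {x} {y} t∈ black-lr = begin
      sumℤ (map term (whiteVertices ds col))
        ≡⟨ sumℤ-pair term (whiteVertices ds col) (whiteVertices-unique ds col) ll∈ ur∈ ll≢ur vanish ⟩
      term (x , y) ℤ.+ term (suc x , suc y)
        ≡⟨ cong₂ ℤ._+_ (cong₂ ℤ._*_ (B-step w west  bottom) (B-step w south left))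
                       (cong₂ ℤ._*_ (B-step w north right)  (B-step w east  top)) ⟩
      signℤ (w (hor x y)) ℤ.* signℤ (w (ver x y)) ℤ.+
      signℤ (w (ver (suc x) y)) ℤ.* signℤ (w (hor x (suc y)))
        ≡⟨ proj₂ (kasteleyn-tile-cancel ds w kasteleyn t∈) ⟩
      0ℤ ∎
      where
      open ≡-Reasoning
      term : Point → ℤ.ℤ
      term k = B ds w (suc x , y) k ℤ.* B ds w (x , suc y) k
      bottom : IsEdge ds (hor x y)
      bottom = side⇒edge t∈ bottom∈
      top : IsEdge ds (hor x (suc y))
      top = side⇒edge t∈ top∈
      left : IsEdge ds (ver x y)
      left = side⇒edge t∈ left∈
      right : IsEdge ds (ver (suc x) y)
      right = side⇒edge t∈ right∈
      ll∈ : (x , y) ∈ whiteVertices ds col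
      ll∈ = white-corner∈whiteVertices ds col t∈ lowerLeft∈
              (white-of-black-neighbour black-lr (≢-sym (proper _ bottom)))
      ur∈ : (suc x , suc y) ∈ whiteVertices ds col
      ur∈ = white-corner∈whiteVertices ds col t∈ upperRight∈
              (white-of-black-neighbour black-lr (proper _ right))
      ll≢ur : (x , y) ≢ (suc x , suc y)
      ll≢ur eq = 1+n≢n (sym (cong proj₁ eq))
      vanish : ∀ {k} → k ∈ whiteVertices ds col → k ≢ (x , y) → k ≢ (suc x , suc y) → term k ≡ 0ℤ
      vanish _ = B-product≡0-outside w antidiagonal-common-neighbour

    BBᵀ-opposite-corners≡0 : ∀ {i j} → OppositeCorners ds i j → col i ≡ black → col j ≡ black →
                             BBᵀ ds col w i j ≡ 0ℤ
    BBᵀ-opposite-corners≡0 (sw-ne t∈) black-i _ = BBᵀ-diagonal≡0 t∈ black-i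
    BBᵀ-opposite-corners≡0 {i} {j} (ne-sw t∈) _ black-j =
      trans (BBᵀ-sym i j) (BBᵀ-diagonal≡0 t∈ black-j)
    BBᵀ-opposite-corners≡0 (se-nw t∈) black-i _ = BBᵀ-antidiagonal≡0 t∈ black-i
    BBᵀ-opposite-corners≡0 {i} {j} (nw-se t∈) _ black-j =
      trans (BBᵀ-sym i j) (BBᵀ-antidiagonal≡0 t∈ black-j)

  term≡0⊎opposite-corners : (∀ p → IsTurn ds p → col p ≡ black) →
    ∀ {i j} → OnOppositeBoundaries ds i j →
    ∀ {k} → col k ≡ white → B ds w i k ℤ.* B ds w j k ≡ 0ℤ ⊎ OppositeCorners ds i j
  term≡0⊎opposite-corners turns-black {i} {j} opp {k} k-white with B-product≡0⊎adjacent w i j k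
  ... | inj₁ term≡0 = inj₁ term≡0
  ... | inj₂ ((_ , s₁ , e₁∈) , (_ , s₂ , e₂∈)) =
    inj₂ (common-neighbour⇒opposite-corners ds s₁ s₂ e₁∈ e₂∈ k-not-turn opp)
    where
    k-not-turn : ¬ IsTurn ds k
    k-not-turn turn with () ← trans (sym (turns-black k turn)) k-white

proposition2p24 : (ds : List Dir) (col : Point → Colour) (w : Edge → Sign) →
    ProperColouring ds col →
    (∀ p → IsTurn ds p → col p ≡ black) →
    Kasteleyn ds w →
    (i j : Point) → col i ≡ black → col j ≡ black →
    OnUpperBoundary ds i → OnLowerBoundary ds j →
    BBᵀ ds col w i j ≡ 0ℤ
proposition2p24 ds col w proper turns-black kasteleyn i j black-i black-j upper lower
  with sumℤ-zero-or (λ k → B ds w i k ℤ.* B ds w j k) (whiteVertices ds col)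
         (λ k∈ → term≡0⊎opposite-corners ds col w turns-black (inj₁ (upper , lower))
                                         (whiteVertices-white ds col k∈))
... | inj₁ BBᵀ≡0  = BBᵀ≡0
... | inj₂ corners = BBᵀ-opposite-corners≡0 ds col w proper kasteleyn corners black-i black-j
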